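{- For every $N$ and every request sequence $I$ respecting the path access graph $P_N$, $$\mathrm{LRU}^{P_N}_W(I)\le \mathrm{FIFO}^{P_N}_W(I).$$
   Context: Paging: a cache of size $k\ge1$, initially empty; on a request to a page not in cache (a fault) the page is brought in, evicting a page if the cache is full; $\mathrm{A}(I)$ is the number of faults of algorithm $\mathrm{A}$ on sequence $I$. LRU evicts the least recently requested page in cache; FIFO evicts the page that has been in cache the longest. An access graph is an undirected graph whose vertices are the pages; a sequence respects it if any two consecutive requests are to the same page or to adjacent vertices. $P_N$ is the path graph on $N$ vertices. For an algorithm $\mathrm{A}$ and access graph $G$, $\mathrm{A}^G_W(I)=\max_\sigma \mathrm{A}(\sigma(I))$, the maximum over all permutations $\sigma$ of the requests of $I$ such that the reordered sequence $\sigma(I)$ respects $G$. -}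

module Defs where

open import Data.Nat using (ℕ; zero; suc; _+_; _<ᵇ_; _≤_)
open import Data.Bool using (Bool; true; false; if_then_else_)
open import Data.Fin using (Fin; toℕ; _≟_)
open import Data.List using (List; []; _∷_; length; filter; reverse)
open import Data.List.Relation.Binary.Permutation.Propositional using (_↭_)
open import Data.Product using (Σ; _×_; _,_)
open import Data.Sum using (_⊎_)
open import Data.Unit using (⊤)
open import Relation.Binary.PropositionalEquality using (_≡_)
open import Relation.Nullary using (¬_; yes; no)
open import Relation.Nullary.Decidable using (⌊_⌋)

PathAdj : {N : ℕ} → Fin N → Fin N → Set
PathAdj i j = (suc (toℕ i) ≡ toℕ j) ⊎ (suc (toℕ j) ≡ toℕ i)

Respects : {N : ℕ} → List (Fin N) → Set
Respects [] = ⊤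
Respects (p ∷ []) = ⊤
Respects (p ∷ q ∷ rest) = ((p ≡ q) ⊎ PathAdj p q) × Respects (q ∷ rest)

mem : {N : ℕ} → Fin N → List (Fin N) → Bool
mem p [] = false
mem p (q ∷ qs) with p ≟ q
... | yes _ = true
... | no _ = mem p qs

remove : {N : ℕ} → Fin N → List (Fin N) → List (Fin N)
remove p [] = []
remove p (q ∷ qs) with p ≟ q
... | yes _ = remove p qs
... | no _ = q ∷ remove p qs

dropLast : {A : Set} → List A → List A
dropLast [] = []
dropLast (x ∷ []) = []
dropLast (x ∷ y ∷ xs) = x ∷ dropLast (y ∷ xs)

-- insert a new page at the front, evicting the last one if the cache is full
-- (length ≥ k).  Cache lists are ordered with the "youngest" page first.
insertFront : {N : ℕ} → ℕ → Fin N → List (Fin N) → List (Fin N)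
insertFront k p c = if length c <ᵇ k then p ∷ c else p ∷ dropLast c

-- LRU: the cache is ordered by recency of last request (most recent first);
-- the last element is the least recently requested page.
-- lruRun k cache I = number of faults on I starting from cache.
lruRun : {N : ℕ} → ℕ → List (Fin N) → List (Fin N) → ℕ
lruRun k c [] = 0
lruRun k c (p ∷ I) = if mem p c
  then lruRun k (p ∷ remove p c) I
  else suc (lruRun k (insertFront k p c) I)

-- FIFO: the cache is ordered by time of insertion (newest first);
-- hits do not change the order; the last element has been in cache longest.
fifoRun : {N : ℕ} → ℕ → List (Fin N) → List (Fin N) → ℕ
fifoRun k c [] = 0
fifoRun k c (p ∷ I) = if mem p c
  then fifoRun k c I
  else suc (fifoRun k (insertFront k p c) I)

LRU : {N : ℕ} → ℕ → List (Fin N) → ℕ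
LRU k I = lruRun k [] I

FIFO : {N : ℕ} → ℕ → List (Fin N) → ℕ
FIFO k I = fifoRun k [] I

-- m is A^{P_N}_W(I): the maximum of A(J) over all reorderings J of the
-- requests of I (J a permutation of I) that respect P_N.
IsWorstOrder : {N : ℕ} → (List (Fin N) → ℕ) → List (Fin N) → ℕ → Set
IsWorstOrder {N} A I m =
  Σ (List (Fin N)) (λ J → (J ↭ I) × Respects J × (A J ≡ m))
  × ((J : List (Fin N)) → J ↭ I → Respects J → A J ≤ m)

-- The LRU-worst order J of I respects P_N, and on every single walk LRU faults
-- at most as often as FIFO (lru≤fifo); FIFO's worst order bounds FIFO(J).
-- lru≤fifo is an amortised invariant kept request by request.  On a walk the
-- LRU cache is a window of consecutive pages around the current page (Shape),
-- and LRU faults exactly when the walk leaves this window.  FIFO is measured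
-- by anchors: a snapshot of its cache at an earlier moment and the window
-- visited since, each window position missing from the snapshot having cost
-- FIFO a fault.  A credit is an anchor wide enough to pay for all LRU faults
-- since it was taken, and yields LRU ≤ FIFO.  Hits keep the credit; at a
-- fault either the credit window grows by the new page, or the cache is full
-- and the anchor taken at the previous fault, spanning the k cached pages,
-- takes over.
module Submission where

open import Defs
open import Data.Nat using (ℕ; zero; suc; _+_; _∸_; _≤_; _<_; _<ᵇ_; _<?_; z≤n; s≤s)
open import Data.Nat.Properties
open import Data.Bool using (Bool; true; false; if_then_else_; T)
open import Data.Fin using (Fin; toℕ)
open import Data.Fin.Properties using (toℕ-injective) renaming (_≟_ to _≟ᶠ_)
open import Data.List using (List; []; _∷_; length)
open import Data.List.Relation.Ternary.Interleaving.Propositional using (Interleaving; []; consˡ; consʳ)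
open import Data.Product using (Σ; _×_; _,_; proj₁; proj₂)
open import Data.Sum using (_⊎_; inj₁; inj₂; [_,_])
open import Data.Empty using (⊥; ⊥-elim)
open import Function using (_∘_)
open import Data.Unit using (⊤; tt)
open import Relation.Binary.PropositionalEquality using (_≡_; _≢_; refl; sym; trans; cong; subst; subst₂; module ≡-Reasoning)
open import Relation.Nullary using (¬_; yes; no)

-- Membership by position.  Windows of the path are ranges of natural
-- numbers, so cache contents are queried by the position of a page.
module _ {N : ℕ} where

  memAt : ℕ → List (Fin N) → Bool
  memAt z [] = false
  memAt z (q ∷ qs) with toℕ q ≟ z
  ... | yes _ = true
  ... | no _ = memAt z qs

  mem≡memAt : (p : Fin N) (S : List (Fin N)) → mem p S ≡ memAt (toℕ p) S
  mem≡memAt p [] = refl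
  mem≡memAt p (q ∷ qs) with p ≟ᶠ q | toℕ q ≟ toℕ p
  ... | yes _    | yes _ = refl
  ... | yes refl | no q≢p = ⊥-elim (q≢p refl)
  ... | no p≢q   | yes q≡p = ⊥-elim (p≢q (toℕ-injective (sym q≡p)))
  ... | no _     | no _ = mem≡memAt p qs

  memAt-here : (q : Fin N) (qs : List (Fin N)) → memAt (toℕ q) (q ∷ qs) ≡ true
  memAt-here q qs with toℕ q ≟ toℕ q
  ... | yes _ = refl
  ... | no q≢q = ⊥-elim (q≢q refl)

  memAt-there : ∀ z (q : Fin N) qs → memAt z qs ≡ true → memAt z (q ∷ qs) ≡ true
  memAt-there z q qs h with toℕ q ≟ z
  ... | yes _ = refl
  ... | no _ = h

  memAt-skip : ∀ z (q : Fin N) qs → toℕ q ≢ z → memAt z (q ∷ qs) ≡ memAt z qs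
  memAt-skip z q qs q≢z with toℕ q ≟ z
  ... | yes q≡z = ⊥-elim (q≢z q≡z)
  ... | no _ = refl

  memAt-cons⁻ : ∀ z (q : Fin N) qs → memAt z (q ∷ qs) ≡ true → toℕ q ≡ z ⊎ memAt z qs ≡ true
  memAt-cons⁻ z q qs h with toℕ q ≟ z
  ... | yes q≡z = inj₁ q≡z
  ... | no _ = inj₂ h

  memAt-absent⁻ : ∀ z (q : Fin N) qs → memAt z (q ∷ qs) ≡ false → toℕ q ≢ z × memAt z qs ≡ false
  memAt-absent⁻ z q qs h with toℕ q ≟ z
  memAt-absent⁻ z q qs () | yes _
  ... | no q≢z = q≢z , h

module _ {N : ℕ} where

  absent : ℕ → List (Fin N) → ℕ
  absent z S = if memAt z S then 0 else 1

  missing : ℕ → ℕ → List (Fin N) → ℕ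
  missing x zero S = 0
  missing x (suc w) S = absent x S + missing (suc x) w S

  absent≤1 : ∀ z S → absent z S ≤ 1
  absent≤1 z S with memAt z S
  ... | true = z≤n
  ... | false = s≤s z≤n

  missing-snoc : ∀ x w S → missing x (suc w) S ≡ missing x w S + absent (x + w) S
  missing-snoc x zero S rewrite +-identityʳ x = +-comm (absent x S) 0
  missing-snoc x (suc w) S rewrite missing-snoc (suc x) w S | +-suc x w =
    sym (+-assoc (absent x S) (missing (suc x) w S) (absent (suc (x + w)) S))

  missing-below : ∀ x w s S → toℕ s < x → missing x w (s ∷ S) ≡ missing x w S
  missing-below x zero s S s<x = refl
  missing-below x (suc w) s S s<x
    rewrite memAt-skip x s S (<⇒≢ s<x) | missing-below (suc x) w s S (m<n⇒m<1+n s<x) = refl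

  missing-cons : ∀ x w s S → missing x w S ≤ missing x w (s ∷ S) + 1
  missing-cons x zero s S = z≤n
  missing-cons x (suc w) s S with toℕ s ≟ x
  ... | yes s≡x rewrite missing-below (suc x) w s S (≤-reflexive (cong suc s≡x)) =
    begin
      absent x S + missing (suc x) w S ≤⟨ +-monoˡ-≤ _ (absent≤1 x S) ⟩
      1 + missing (suc x) w S          ≡⟨ +-comm 1 _ ⟩
      missing (suc x) w S + 1          ∎
    where open ≤-Reasoning
  ... | no _ =
    begin
      absent x S + missing (suc x) w S             ≤⟨ +-monoʳ-≤ (absent x S) (missing-cons (suc x) w s S) ⟩
      absent x S + (missing (suc x) w (s ∷ S) + 1) ≡⟨ sym (+-assoc (absent x S) _ 1) ⟩
      absent x S + missing (suc x) w (s ∷ S) + 1   ∎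
    where open ≤-Reasoning

  missing-[] : ∀ x w → missing x w [] ≡ w
  missing-[] x zero = refl
  missing-[] x (suc w) = cong suc (missing-[] (suc x) w)

  width≤missing+length : ∀ x w S → w ≤ missing x w S + length S
  width≤missing+length x w [] rewrite missing-[] x w | +-identityʳ w = ≤-refl
  width≤missing+length x w (s ∷ S) =
    begin
      w                                  ≤⟨ width≤missing+length x w S ⟩
      missing x w S + length S           ≤⟨ +-monoˡ-≤ (length S) (missing-cons x w s S) ⟩
      missing x w (s ∷ S) + 1 + length S ≡⟨ +-assoc (missing x w (s ∷ S)) 1 (length S) ⟩
      missing x w (s ∷ S) + length (s ∷ S) ∎
    where open ≤-Reasoning

dropLast-length : ∀ {A : Set} (S : List A) → length (dropLast S) ≡ length S ∸ 1
dropLast-length [] = refl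
dropLast-length (x ∷ []) = refl
dropLast-length (x ∷ y ∷ S) rewrite dropLast-length (y ∷ S) = refl

memAt-dropLast : ∀ {N} z (S : List (Fin N)) → memAt z (dropLast S) ≡ true → memAt z S ≡ true
memAt-dropLast z [] ()
memAt-dropLast z (x ∷ []) ()
memAt-dropLast z (x ∷ S@(_ ∷ _)) h =
  [ (λ x≡z → subst (λ t → memAt t (x ∷ S) ≡ true) x≡z (memAt-here x S))
  , (λ h′ → memAt-there z x S (memAt-dropLast z S h′))
  ] (memAt-cons⁻ z x (dropLast S) h)

<ᵇ-true : ∀ m n → (m <ᵇ n) ≡ true → m < n
<ᵇ-true m n e = <ᵇ⇒< m n (subst T (sym e) tt)

<ᵇ-false : ∀ m n → (m <ᵇ n) ≡ false → n ≤ m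
<ᵇ-false m n e = ≮⇒≥ (λ m<n → subst T e (<⇒<ᵇ m<n))

module _ {N : ℕ} (k : ℕ) where

  insertFront-cases : ∀ (p : Fin N) S →
    ((length S <ᵇ k) ≡ true × insertFront k p S ≡ p ∷ S) ⊎
    ((length S <ᵇ k) ≡ false × insertFront k p S ≡ p ∷ dropLast S)
  insertFront-cases p S with length S <ᵇ k
  ... | true = inj₁ (refl , refl)
  ... | false = inj₂ (refl , refl)

  insertFront-memAt : ∀ z (p : Fin N) S → memAt z (insertFront k p S) ≡ true → toℕ p ≡ z ⊎ memAt z S ≡ true
  insertFront-memAt z p S h with length S <ᵇ k
  ... | true = memAt-cons⁻ z p S h
  ... | false with memAt-cons⁻ z p (dropLast S) h
  ...   | inj₁ p≡z = inj₁ p≡z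
  ...   | inj₂ h′ = inj₂ (memAt-dropLast z S h′)

  insertFront-here : ∀ (p : Fin N) S → memAt (toℕ p) (insertFront k p S) ≡ true
  insertFront-here p S with length S <ᵇ k
  ... | true = memAt-here p S
  ... | false = memAt-here p (dropLast S)

  insertFront-length : 1 ≤ k → ∀ (p : Fin N) S → length S ≤ k → length (insertFront k p S) ≤ k
  insertFront-length 1≤k p S h with length S <ᵇ k in eq
  ... | true = <ᵇ-true (length S) k eq
  ... | false rewrite dropLast-length S with S
  ...   | [] = 1≤k
  ...   | _ ∷ _ = h

  cost : Fin N → List (Fin N) → ℕ
  cost p S = if mem p S then 0 else 1

  cost-absent : ∀ p S → memAt (toℕ p) S ≡ false → cost p S ≡ 1
  cost-absent p S h rewrite mem≡memAt p S | h = refl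

  fifoNext : Fin N → List (Fin N) → List (Fin N)
  fifoNext p F = if mem p F then F else insertFront k p F

  lruNext : Fin N → List (Fin N) → List (Fin N)
  lruNext p L = if mem p L then p ∷ remove p L else insertFront k p L

  fifoRun-step : ∀ p F I → fifoRun k F (p ∷ I) ≡ cost p F + fifoRun k (fifoNext p F) I
  fifoRun-step p F I with mem p F
  ... | true = refl
  ... | false = refl

  lruRun-step : ∀ p L I → lruRun k L (p ∷ I) ≡ cost p L + lruRun k (lruNext p L) I
  lruRun-step p L I with mem p L
  ... | true = refl
  ... | false = refl

  fifoNext-memAt : ∀ z p F → memAt z (fifoNext p F) ≡ true → toℕ p ≡ z ⊎ memAt z F ≡ true
  fifoNext-memAt z p F h with mem p F
  ... | true = inj₂ h
  ... | false = insertFront-memAt z p F h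

  fifoNext-here : ∀ p F → memAt (toℕ p) (fifoNext p F) ≡ true
  fifoNext-here p F with mem p F in eq
  ... | true = trans (sym (mem≡memAt p F)) eq
  ... | false = insertFront-here p F

  fifoNext-length : 1 ≤ k → ∀ p F → length F ≤ k → length (fifoNext p F) ≤ k
  fifoNext-length 1≤k p F h with mem p F
  ... | true = h
  ... | false = insertFront-length 1≤k p F h

-- On a walk along the path, the
-- pages requested since any moment form a window around the current page,
-- so the LRU cache is always c ∷ R where R interleaves the pages
-- c + 1, c + 2, … (in this order) with the pages c - 1, c - 2, ….
module _ {N : ℕ} where

  Ascending : ℕ → List (Fin N) → Set
  Ascending n [] = ⊤
  Ascending n (x ∷ xs) = (toℕ x ≡ suc n) × Ascending (suc n) xs

  Descending : ℕ → List (Fin N) → Set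
  Descending n [] = ⊤
  Descending n (x ∷ xs) = (suc (toℕ x) ≡ n) × Descending (toℕ x) xs

  ascending-absent : ∀ n U z → Ascending n U → z ≤ n → memAt z U ≡ false
  ascending-absent n [] z _ _ = refl
  ascending-absent n (x ∷ U) z (x≡1+n , asc) z≤
    rewrite memAt-skip z x U (λ x≡z → <⇒≢ (s≤s z≤) (trans (sym x≡z) x≡1+n)) =
    ascending-absent (suc n) U z asc (m≤n⇒m≤1+n z≤)

  descending-absent : ∀ n D z → Descending n D → n ≤ z → memAt z D ≡ false
  descending-absent n [] z _ _ = refl
  descending-absent n (x ∷ D) z (1+x≡n , desc) n≤z
    rewrite memAt-skip z x D (λ x≡z → <⇒≢ (subst (_≤ z) (sym 1+x≡n) n≤z) x≡z) =
    descending-absent (toℕ x) D z desc (≤-trans (n≤1+n _) (subst (_≤ z) (sym 1+x≡n) n≤z))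

  ascending-dropLast : ∀ n U → Ascending n U → Ascending n (dropLast U)
  ascending-dropLast n [] _ = tt
  ascending-dropLast n (x ∷ []) _ = tt
  ascending-dropLast n (x ∷ U@(_ ∷ _)) (e , asc) = e , ascending-dropLast (suc n) U asc

  descending-dropLast : ∀ n D → Descending n D → Descending n (dropLast D)
  descending-dropLast n [] _ = tt
  descending-dropLast n (x ∷ []) _ = tt
  descending-dropLast n (x ∷ D@(_ ∷ _)) (e , desc) = e , descending-dropLast (toℕ x) D desc

  interleaving-absent : ∀ {U D R : List (Fin N)} z → Interleaving U D R →
    memAt z U ≡ false → memAt z D ≡ false → memAt z R ≡ false
  interleaving-absent z [] _ _ = refl
  interleaving-absent {x ∷ U} {R = _ ∷ R} z (consˡ sp) hU hD =
    let (x≢z , hU′) = memAt-absent⁻ z x U hU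
    in trans (memAt-skip z x R x≢z) (interleaving-absent z sp hU′ hD)
  interleaving-absent {D = x ∷ D} {R = _ ∷ R} z (consʳ sp) hU hD =
    let (x≢z , hD′) = memAt-absent⁻ z x D hD
    in trans (memAt-skip z x R x≢z) (interleaving-absent z sp hU hD′)

  interleaving-memˡ : ∀ {U D R : List (Fin N)} z → Interleaving U D R → memAt z U ≡ true → memAt z R ≡ true
  interleaving-memˡ {x ∷ U} {R = _ ∷ R} z (consˡ sp) h with memAt-cons⁻ z x U h
  ... | inj₁ refl = memAt-here x R
  ... | inj₂ h′ = memAt-there z x R (interleaving-memˡ z sp h′)
  interleaving-memˡ {R = x ∷ R} z (consʳ sp) h = memAt-there z x R (interleaving-memˡ z sp h)

  interleaving-memʳ : ∀ {U D R : List (Fin N)} z → Interleaving U D R → memAt z D ≡ true → memAt z R ≡ true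
  interleaving-memʳ {D = x ∷ D} {R = _ ∷ R} z (consʳ sp) h with memAt-cons⁻ z x D h
  ... | inj₁ refl = memAt-here x R
  ... | inj₂ h′ = memAt-there z x R (interleaving-memʳ z sp h′)
  interleaving-memʳ {R = x ∷ R} z (consˡ sp) h = memAt-there z x R (interleaving-memʳ z sp h)

  remove-absent : ∀ (p : Fin N) S → memAt (toℕ p) S ≡ false → remove p S ≡ S
  remove-absent p [] h = refl
  remove-absent p (q ∷ S) h with p ≟ᶠ q | memAt-absent⁻ (toℕ p) q S h
  ... | yes refl | q≢p , _ = ⊥-elim (q≢p refl)
  ... | no _     | _ , h′ = cong (q ∷_) (remove-absent p S h′)

  remove-here : ∀ (p : Fin N) S → remove p (p ∷ S) ≡ remove p S
  remove-here p S with p ≟ᶠ p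
  ... | yes _ = refl
  ... | no p≢p = ⊥-elim (p≢p refl)

  remove-skip : ∀ (p q : Fin N) S → p ≢ q → remove p (q ∷ S) ≡ q ∷ remove p S
  remove-skip p q S p≢q with p ≟ᶠ q
  ... | yes p≡q = ⊥-elim (p≢q p≡q)
  ... | no _ = refl

  remove-interleavingˡ : ∀ (u : Fin N) {U D R} → Interleaving (u ∷ U) D R →
    memAt (toℕ u) U ≡ false → memAt (toℕ u) D ≡ false →
    Σ (List (Fin N)) λ R′ → Interleaving U D R′ × remove u R ≡ R′
  remove-interleavingˡ u {R = _ ∷ R} (consˡ sp) hU hD =
    R , sp , trans (remove-here u R) (remove-absent u R (interleaving-absent (toℕ u) sp hU hD))
  remove-interleavingˡ u {D = y ∷ D} {R = _ ∷ R} (consʳ sp) hU hD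
    with memAt-absent⁻ (toℕ u) y D hD
  ... | y≢u , hD′ with remove-interleavingˡ u sp hU hD′
  ...   | R′ , sp′ , eq =
    y ∷ R′ , consʳ sp′ , trans (remove-skip u y R (λ u≡y → y≢u (cong toℕ (sym u≡y)))) (cong (y ∷_) eq)

  remove-interleavingʳ : ∀ (d : Fin N) {U D R} → Interleaving U (d ∷ D) R →
    memAt (toℕ d) U ≡ false → memAt (toℕ d) D ≡ false →
    Σ (List (Fin N)) λ R′ → Interleaving U D R′ × remove d R ≡ R′
  remove-interleavingʳ d {R = _ ∷ R} (consʳ sp) hU hD =
    R , sp , trans (remove-here d R) (remove-absent d R (interleaving-absent (toℕ d) sp hU hD))
  remove-interleavingʳ d {U = x ∷ U} {R = _ ∷ R} (consˡ sp) hU hD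
    with memAt-absent⁻ (toℕ d) x U hU
  ... | x≢d , hU′ with remove-interleavingʳ d sp hU′ hD
  ...   | R′ , sp′ , eq =
    x ∷ R′ , consˡ sp′ , trans (remove-skip d x R (λ d≡x → x≢d (cong toℕ (sym d≡x)))) (cong (x ∷_) eq)

  interleaving-[]ˡ : ∀ {X Y : List (Fin N)} → Interleaving [] X Y → Y ≡ X
  interleaving-[]ˡ [] = refl
  interleaving-[]ˡ (consʳ sp) = cong (_ ∷_) (interleaving-[]ˡ sp)

  interleaving-[]ʳ : ∀ {X Y : List (Fin N)} → Interleaving X [] Y → Y ≡ X
  interleaving-[]ʳ [] = refl
  interleaving-[]ʳ (consˡ sp) = cong (_ ∷_) (interleaving-[]ʳ sp)

  record Shape (c : Fin N) (U D R : List (Fin N)) : Set where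
    constructor shape
    field
      merged      : Interleaving U D R
      ascending   : Ascending (toℕ c) U
      descending  : Descending (toℕ c) D

  shape-onlyBelow : ∀ (c : Fin N) D → Descending (toℕ c) D → Shape c [] D D
  shape-onlyBelow c D desc = shape (right D) tt desc
    where
      right : ∀ X → Interleaving [] X X
      right [] = []
      right (_ ∷ X) = consʳ (right X)

  shape-onlyAbove : ∀ (c : Fin N) U → Ascending (toℕ c) U → Shape c U [] U
  shape-onlyAbove c U asc = shape (left U) asc tt
    where
      left : ∀ X → Interleaving X [] X
      left [] = []
      left (_ ∷ X) = consˡ (left X)

module _ {N : ℕ} (k : ℕ) where

  lru-repeat : ∀ {c : Fin N} {U D R} → Shape c U D R →
    cost k c (c ∷ R) ≡ 0 × lruNext k c (c ∷ R) ≡ c ∷ R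
  lru-repeat {c} {U} {D} {R} (shape sp asc desc)
    rewrite mem≡memAt c (c ∷ R) | memAt-here c R | remove-here c R
          | remove-absent c R (interleaving-absent (toℕ c) sp (ascending-absent (toℕ c) U (toℕ c) asc ≤-refl)
                                                             (descending-absent (toℕ c) D (toℕ c) desc ≤-refl))
    = refl , refl

  lru-hitAbove : ∀ {c p u : Fin N} {U D R} → Shape c (u ∷ U) D R → suc (toℕ c) ≡ toℕ p →
    cost k p (c ∷ R) ≡ 0 × Σ (List (Fin N)) λ R′ → lruNext k p (c ∷ R) ≡ p ∷ R′ × Shape p U (c ∷ D) R′
  lru-hitAbove {c} {p} {u} {U} {D} {R} (shape sp (u≡1+c , asc) desc) 1+c≡p
    with toℕ-injective (trans u≡1+c 1+c≡p)
  ... | refl with remove-interleavingˡ u sp (ascending-absent (suc (toℕ c)) U (toℕ u) asc (≤-reflexive u≡1+c))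
                     (descending-absent (toℕ c) D (toℕ u) desc (subst (toℕ c ≤_) (sym u≡1+c) (n≤1+n _)))
  ... | R′ , sp′ , eq
    rewrite mem≡memAt u (c ∷ R)
          | memAt-there (toℕ u) c R (interleaving-memˡ (toℕ u) sp (memAt-here u U))
          | remove-skip u c R (λ u≡c → <⇒≢ (subst (toℕ c <_) (sym u≡1+c) (n<1+n (toℕ c))) (cong toℕ (sym u≡c)))
          | eq
    = refl , c ∷ R′ , refl , shape (consʳ sp′) (subst (λ t → Ascending t U) (sym u≡1+c) asc) (1+c≡p , desc)

  lru-hitBelow : ∀ {c p d : Fin N} {U D R} → Shape c U (d ∷ D) R → suc (toℕ p) ≡ toℕ c →
    cost k p (c ∷ R) ≡ 0 × Σ (List (Fin N)) λ R′ → lruNext k p (c ∷ R) ≡ p ∷ R′ × Shape p (c ∷ U) D R′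
  lru-hitBelow {c} {p} {d} {U} {D} {R} (shape sp asc (1+d≡c , desc)) 1+p≡c
    with toℕ-injective (suc-injective (trans 1+d≡c (sym 1+p≡c)))
  ... | refl with remove-interleavingʳ d sp
                     (ascending-absent (toℕ c) U (toℕ d) asc (subst (toℕ d ≤_) 1+d≡c (n≤1+n (toℕ d))))
                     (descending-absent (toℕ d) D (toℕ d) desc ≤-refl)
  ... | R′ , sp′ , eq
    rewrite mem≡memAt d (c ∷ R)
          | memAt-there (toℕ d) c R (interleaving-memʳ (toℕ d) sp (memAt-here d D))
          | remove-skip d c R (λ d≡c → <⇒≢ (subst (toℕ d <_) 1+d≡c (n<1+n (toℕ d))) (cong toℕ d≡c))
          | eq
    = refl , c ∷ R′ , refl , shape (consˡ sp′) (sym 1+p≡c , subst (λ t → Ascending t U) (sym 1+p≡c) asc) desc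

  lru-faultAbove : ∀ {c p : Fin N} {D R} → Shape c [] D R → suc (toℕ c) ≡ toℕ p →
    cost k p (c ∷ R) ≡ 1 × lruNext k p (c ∷ R) ≡ insertFront k p (c ∷ D)
  lru-faultAbove {c} {p} {D} {R} (shape sp _ desc) 1+c≡p with interleaving-[]ˡ sp
  ... | refl
    rewrite mem≡memAt p (c ∷ D)
          | memAt-skip (toℕ p) c D (<⇒≢ (subst (toℕ c <_) 1+c≡p (n<1+n (toℕ c))))
          | descending-absent (toℕ c) D (toℕ p) desc (subst (toℕ c ≤_) 1+c≡p (n≤1+n (toℕ c)))
    = refl , refl

  lru-faultBelow : ∀ {c p : Fin N} {U R} → Shape c U [] R → suc (toℕ p) ≡ toℕ c →
    cost k p (c ∷ R) ≡ 1 × lruNext k p (c ∷ R) ≡ insertFront k p (c ∷ U)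
  lru-faultBelow {c} {p} {U} {R} (shape sp asc _) 1+p≡c with interleaving-[]ʳ sp
  ... | refl
    rewrite mem≡memAt p (c ∷ U)
          | memAt-skip (toℕ p) c U (λ c≡p → <⇒≢ (subst (toℕ p <_) 1+p≡c (n<1+n (toℕ p))) (sym c≡p))
          | ascending-absent (toℕ c) U (toℕ p) asc (subst (toℕ p ≤_) 1+p≡c (n≤1+n (toℕ p)))
    = refl , refl

data Extend (x w p : ℕ) : ℕ → ℕ → Set where
  inside : x ≤ p → p < x + w → Extend x w p x w
  above  : p ≡ x + w → Extend x w p x (suc w)
  below  : suc p ≡ x → Extend x w p p (suc w)

extend : ∀ {N} x w {c p : Fin N} → x ≤ toℕ c → toℕ c < x + w → (c ≡ p) ⊎ PathAdj c p →
  Σ ℕ λ x′ → Σ ℕ λ w′ → Extend x w (toℕ p) x′ w′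
extend x w x≤c c<x+w (inj₁ refl) = x , w , inside x≤c c<x+w
extend x w {c} {p} x≤c c<x+w (inj₂ (inj₁ 1+c≡p)) with toℕ p ≟ x + w
... | yes p≡x+w = x , suc w , above p≡x+w
... | no p≢x+w = x , w , inside (≤-trans x≤c (subst (toℕ c ≤_) 1+c≡p (n≤1+n _)))
                               (≤∧≢⇒< (subst (_≤ x + w) 1+c≡p c<x+w) p≢x+w)
extend x w {c} {p} x≤c c<x+w (inj₂ (inj₂ 1+p≡c)) with suc (toℕ p) ≟ x
... | yes 1+p≡x = toℕ p , suc w , below 1+p≡x
... | no 1+p≢x = x , w , inside (≤-pred (≤∧≢⇒< (subst (x ≤_) (sym 1+p≡c) x≤c) (1+p≢x ∘ sym)))
                               (<-trans (n<1+n (toℕ p)) (subst (_< x + w) (sym 1+p≡c) c<x+w))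

extend-contains : ∀ {x w p x′ w′} → Extend x w p x′ w′ → x′ ≤ p × p < x′ + w′
extend-contains (inside x≤p p<x+w) = x≤p , p<x+w
extend-contains {x} {w} (above refl) = m≤m+n x w , subst (x + w <_) (sym (+-suc x w)) (n<1+n _)
extend-contains {w = w} {p = p} (below refl) = ≤-refl , subst (p <_) (sym (+-suc p w)) (s≤s (m≤m+n p w))

extend-⊇ : ∀ {x w p x′ w′} → Extend x w p x′ w′ → ∀ z → x ≤ z × z < x + w → x′ ≤ z × z < x′ + w′
extend-⊇ (inside _ _) z z∈ = z∈
extend-⊇ {x} {w} (above refl) z (x≤z , z<x+w) = x≤z , subst (z <_) (sym (+-suc x w)) (m<n⇒m<1+n z<x+w)
extend-⊇ {x} {w} {p} (below refl) z (x≤z , z<x+w) = ≤-trans (n≤1+n p) x≤z , subst (z <_) (sym (+-suc p w)) z<x+w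

extend-width : ∀ {x w p x′ w′} → Extend x w p x′ w′ → w ≤ w′
extend-width (inside _ _) = ≤-refl
extend-width (above _) = n≤1+n _
extend-width (below _) = n≤1+n _

Within : ℕ → ℕ → ℕ → ℕ → Set
Within lo top x w = lo ≤ x × x + w ≤ top

module _ {lo hi p x w x′ w′ : ℕ} (lo≤p : lo ≤ p) (p≤hi : p ≤ hi) where

  extend-within : Extend x w p x′ w′ → Within lo (suc hi) x w → Within lo (suc hi) x′ w′
  extend-within (inside _ _) within = within
  extend-within (above p≡x+w) (lo≤x , _) =
    lo≤x , subst (_≤ suc hi) (sym (trans (+-suc x w) (cong suc (sym p≡x+w)))) (s≤s p≤hi)
  extend-within (below 1+p≡x) (_ , end≤) =
    lo≤p , subst (_≤ suc hi) (sym (trans (+-suc p w) (cong (_+ w) 1+p≡x))) end≤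

  extend-from≡ : Extend x w p x′ w′ → x ≡ lo → x′ ≡ lo
  extend-from≡ (inside _ _) x≡lo = x≡lo
  extend-from≡ (above _) x≡lo = x≡lo
  extend-from≡ (below 1+p≡x) x≡lo = ⊥-elim (1+n≰n (subst (_≤ p) (sym (trans 1+p≡x x≡lo)) lo≤p))

  extend-end≡ : Extend x w p x′ w′ → x + w ≡ suc hi → x′ + w′ ≡ suc hi
  extend-end≡ (inside _ _) end≡ = end≡
  extend-end≡ (above p≡x+w) end≡ = ⊥-elim (1+n≰n (subst (_≤ hi) (trans p≡x+w end≡) p≤hi))
  extend-end≡ (below 1+p≡x) end≡ = trans (trans (+-suc p w) (cong (_+ w) 1+p≡x)) end≡

up-not-below : ∀ {x c p} → x ≤ c → suc c ≡ p → suc p ≢ x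
up-not-below x≤c 1+c≡p 1+p≡x =
  1+n≰n (≤-trans (≤-reflexive 1+p≡x) (≤-trans x≤c (≤-trans (n≤1+n _) (≤-reflexive 1+c≡p))))

down-not-above : ∀ {x w c p} → c < x + w → suc p ≡ c → p ≢ x + w
down-not-above c<end 1+p≡c p≡end =
  1+n≰n (≤-trans (≤-reflexive 1+p≡c) (≤-trans (n≤1+n _) (≤-trans c<end (≤-reflexive (sym p≡end)))))

beyond-top : ∀ {c p e} → suc c ≡ p → p < e → e ≤ suc (c + 0) → ⊥
beyond-top {c} 1+c≡p p<e e≤ =
  <-irrefl refl (<-≤-trans p<e (≤-trans e≤ (≤-reflexive (trans (cong suc (+-identityʳ c)) 1+c≡p))))

beyond-bottom : ∀ {c p lo x} → suc p ≡ c → lo + 0 ≡ c → lo ≤ x → x ≤ p → ⊥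
beyond-bottom {lo = lo} 1+p≡c lo≡c lo≤x x≤p =
  1+n≰n (≤-trans (≤-reflexive (trans 1+p≡c (trans (sym lo≡c) (+-identityʳ lo)))) (≤-trans lo≤x x≤p))

module _ {N : ℕ} where

  Covers : List (Fin N) → List (Fin N) → ℕ → ℕ → Set
  Covers F S x w = ∀ z → memAt z F ≡ true → memAt z S ≡ true ⊎ (x ≤ z × z < x + w)

  -- An anchor records the FIFO cache (snapshot) and fault count (paid) at an
  -- earlier moment, together with a window containing every page requested
  -- since then.  Each window position missing from the snapshot has since
  -- cost FIFO a fault (charged), because FIFO's cache only gains requested pages.
  record Anchor (F : List (Fin N)) (af c : ℕ) : Set where
    field
      snapshot : List (Fin N)
      paid     : ℕ
      from     : ℕ
      width    : ℕ
      charged  : paid + missing from width snapshot ≤ af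
      covered  : Covers F snapshot from width
      current  : from ≤ c × c < from + width

    end : ℕ
    end = from + width

  open Anchor public

  fresh : ∀ F af (c : Fin N) → memAt (toℕ c) F ≡ true → Anchor F af (toℕ c)
  fresh F af c c∈F = record
    { snapshot = F
    ; paid     = af
    ; from     = toℕ c
    ; width    = 1
    ; charged  = ≤-reflexive (trans (cong (λ b → af + ((if b then 0 else 1) + 0)) c∈F) (+-identityʳ af))
    ; covered  = λ z z∈F → inj₁ z∈F
    ; current  = ≤-refl , m<m+n (toℕ c) (s≤s z≤n)
    }

  -- A credit is an anchor whose window has paid in advance for the LRU faults
  -- so far: at the anchored moment LRU had faulted lruPaid ≤ paid times, and
  -- every LRU fault since then is matched by a window position beyond the
  -- snapshot's size.
  record Credit (lf : ℕ) (F : List (Fin N)) (af c : ℕ) : Set where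
    field
      anchor  : Anchor F af c
      lruPaid : ℕ
      budget  : lf + length (snapshot anchor) ≤ lruPaid + width anchor
      cheaper : lruPaid ≤ paid anchor

  open Credit public

  credit⇒lru≤fifo : ∀ {lf F af c} → Credit lf F af c → lf ≤ af
  credit⇒lru≤fifo {lf} {F} {af} C =
    begin
      lf                         ≤⟨ +-cancelʳ-≤ (length S) lf _ lf+S≤ ⟩
      lruPaid C + missing x w S  ≤⟨ +-monoˡ-≤ (missing x w S) (cheaper C) ⟩
      paid A + missing x w S     ≤⟨ charged A ⟩
      af                         ∎
    where
      open ≤-Reasoning
      A = anchor C
      S = snapshot A
      x = from A
      w = width A
      lf+S≤ : lf + length S ≤ lruPaid C + missing x w S + length S
      lf+S≤ =
        begin
          lf + length S                       ≤⟨ budget C ⟩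
          lruPaid C + w                       ≤⟨ +-monoʳ-≤ (lruPaid C) (width≤missing+length x w S) ⟩
          lruPaid C + (missing x w S + length S) ≡⟨ sym (+-assoc (lruPaid C) _ _) ⟩
          lruPaid C + missing x w S + length S ∎

  anchor⇒credit : ∀ {lf F af c} (A : Anchor F af c) → lf ≤ paid A → length (snapshot A) ≤ width A →
    Credit lf F af c
  anchor⇒credit {lf} A lf≤paid S≤w = record
    { anchor = A ; lruPaid = lf ; budget = +-monoʳ-≤ lf S≤w ; cheaper = lf≤paid }

module _ {N : ℕ} (k : ℕ) where

  absent≤cost : ∀ F S x w (p : Fin N) → Covers F S x w → ¬ (x ≤ toℕ p × toℕ p < x + w) →
    absent (toℕ p) S ≤ cost k p F
  absent≤cost F S x w p cov p∉ with memAt (toℕ p) S in p∉S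
  ... | true = z≤n
  ... | false with memAt (toℕ p) F in p∈F
  ...   | false = ≤-reflexive (sym (cost-absent k p F p∈F))
  ...   | true with cov (toℕ p) p∈F
  ...     | inj₁ p∈S = ⊥-elim (true≢false (trans (sym p∈S) p∉S))
    where true≢false : true ≢ false
          true≢false ()
  ...     | inj₂ p∈ = ⊥-elim (p∉ p∈)

  missing-extend : ∀ F S x w (p : Fin N) {x′ w′} → Covers F S x w → Extend x w (toℕ p) x′ w′ →
    missing x′ w′ S ≤ missing x w S + cost k p F
  missing-extend F S x w p cov (inside _ _) = m≤m+n _ _
  missing-extend F S x w p cov (above p≡x+w) =
    begin
      missing x (suc w) S          ≡⟨ missing-snoc x w S ⟩
      missing x w S + absent (x + w) S ≤⟨ +-monoʳ-≤ (missing x w S) (subst (λ t → absent t S ≤ cost k p F) p≡x+w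
                                          (absent≤cost F S x w p cov (λ (_ , p<x+w) → <⇒≢ p<x+w p≡x+w))) ⟩
      missing x w S + cost k p F   ∎
    where open ≤-Reasoning
  missing-extend F S x w p cov (below refl) =
    begin
      absent (toℕ p) S + missing x w S ≤⟨ +-monoˡ-≤ (missing x w S)
                                          (absent≤cost F S x w p cov (λ (x≤p , _) → 1+n≰n x≤p)) ⟩
      cost k p F + missing x w S       ≡⟨ +-comm (cost k p F) _ ⟩
      missing x w S + cost k p F       ∎
    where open ≤-Reasoning

  advance : ∀ {F af c} (A : Anchor F af c) (p : Fin N) {x′ w′} → Extend (from A) (width A) (toℕ p) x′ w′ →
    Anchor (fifoNext k p F) (af + cost k p F) (toℕ p)
  advance {F} {af} A p {x′} {w′} e = record
    { snapshot = snapshot A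
    ; paid     = paid A
    ; from     = x′
    ; width    = w′
    ; charged  =
        begin
          paid A + missing x′ w′ S                        ≤⟨ +-monoʳ-≤ (paid A) (missing-extend F S _ _ p (covered A) e) ⟩
          paid A + (missing (from A) (width A) S + cost k p F) ≡⟨ sym (+-assoc (paid A) _ _) ⟩
          paid A + missing (from A) (width A) S + cost k p F   ≤⟨ +-monoˡ-≤ (cost k p F) (charged A) ⟩
          af + cost k p F                                 ∎
    ; covered  = covered′
    ; current  = extend-contains e
    }
    where
      open ≤-Reasoning
      S = snapshot A
      covered′ : Covers (fifoNext k p F) S x′ w′
      covered′ z z∈ with fifoNext-memAt k z p F z∈
      ... | inj₁ refl = inj₂ (extend-contains e)
      ... | inj₂ z∈F with covered A z z∈F
      ...   | inj₁ z∈S = inj₁ z∈S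
      ...   | inj₂ z∈w = inj₂ (extend-⊇ e z z∈w)

  credit-advance : ∀ {lf F af c} (C : Credit lf F af c) (p : Fin N) {x′ w′} →
    Extend (from (anchor C)) (width (anchor C)) (toℕ p) x′ w′ →
    Credit lf (fifoNext k p F) (af + cost k p F) (toℕ p)
  credit-advance C p e = record
    { anchor  = advance (anchor C) p e
    ; lruPaid = lruPaid C
    ; budget  = ≤-trans (budget C) (+-monoʳ-≤ (lruPaid C) (extend-width e))
    ; cheaper = cheaper C
    }

  -- An LRU fault that widens the window is paid for by the new position.
  credit-grow : ∀ {lf F af c} (C : Credit lf F af c) (p : Fin N) {x′} →
    Extend (from (anchor C)) (width (anchor C)) (toℕ p) x′ (suc (width (anchor C))) →
    Credit (lf + 1) (fifoNext k p F) (af + cost k p F) (toℕ p)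
  credit-grow {lf} C p e = record
    { anchor  = advance (anchor C) p e
    ; lruPaid = lruPaid C
    ; budget  = subst₂ _≤_ (cong (_+ length (snapshot (anchor C))) (+-comm 1 lf))
                           (sym (+-suc (lruPaid C) (width (anchor C))))
                           (s≤s (budget C))
    ; cheaper = cheaper C
    }

module Invariant {N : ℕ} (k : ℕ) (1≤k : 1 ≤ k) where

  -- The invariant relating LRU (cache c ∷ R, lf faults) and FIFO (cache F,
  -- af faults) after a prefix of a walk ending at the page c.  The LRU cache
  -- is the window [lo, hi] with hi = c + |upper| and at most k pages.  Besides
  -- the credit, which gives lf ≤ af, it keeps the anchor `last` taken right
  -- after the latest LRU fault (so lf ≤ paid, and its snapshot is a FIFO cache
  -- of at most k pages); it becomes the next credit when the cache is full.
  -- Both windows reach the same end of [lo, hi + 1), the side of the latest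
  -- fault, and while the cache is not full the credit window stays within it.
  record Inv (c : Fin N) (upper lower R F : List (Fin N)) (lf af : ℕ) : Set where
    field
      lruShape    : Shape c upper lower R
      lruSize     : suc (length upper + length lower) ≤ k
      lo          : ℕ
      lo+lower    : lo + length lower ≡ toℕ c
      fifoSize    : length F ≤ k
      credit      : Credit lf F af (toℕ c)
      last        : Anchor F af (toℕ c)
      lastCheap   : lf ≤ paid last
      lastSmall   : length (snapshot last) ≤ k
      lastWithin  : Within lo (suc (toℕ c + length upper)) (from last) (width last)
      flush       : (from last ≡ lo × from (anchor credit) ≡ lo) ⊎
                    (end last ≡ suc (toℕ c + length upper) × end (anchor credit) ≡ suc (toℕ c + length upper))
      notFull     : suc (length upper + length lower) < k →
                    Within lo (suc (toℕ c + length upper)) (from (anchor credit)) (width (anchor credit))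

  open Inv public

  inv⇒lru≤fifo : ∀ {c U D R F lf af} → Inv c U D R F lf af → lf ≤ af
  inv⇒lru≤fifo I = credit⇒lru≤fifo (credit I)

  follow : ∀ {F : List (Fin N)} {af} {c p : Fin N} (A : Anchor F af (toℕ c)) → (c ≡ p) ⊎ PathAdj c p →
    Σ ℕ λ x′ → Σ ℕ λ w′ → Extend (from A) (width A) (toℕ p) x′ w′
  follow A = extend (from A) (width A) (proj₁ (current A)) (proj₂ (current A))

  hitInv : ∀ {c U D R F lf af} (I : Inv c U D R F lf af) (p : Fin N) → (c ≡ p) ⊎ PathAdj c p →
    ∀ {U′ D′ R′} → Shape p U′ D′ R′ →
    length U′ + length D′ ≡ length U + length D →
    lo I + length D′ ≡ toℕ p → toℕ p + length U′ ≡ toℕ c + length U →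
    Inv p U′ D′ R′ (fifoNext k p F) lf (af + cost k p F)
  hitInv {c} {U} {F = F} I p mv {U′} {D′} shape′ size≡ lo≡ hi≡
    with follow (anchor (credit I)) mv | follow (last I) mv
  ... | _ , _ , ec | _ , _ , el = record
    { lruShape   = shape′
    ; lruSize    = subst (λ t → suc t ≤ k) (sym size≡) (lruSize I)
    ; lo         = lo I
    ; lo+lower   = lo≡
    ; fifoSize   = fifoNext-length k 1≤k p F (fifoSize I)
    ; credit     = credit-advance k (credit I) p ec
    ; last       = advance k (last I) p el
    ; lastCheap  = lastCheap I
    ; lastSmall  = lastSmall I
    ; lastWithin = within el (lastWithin I)
    ; flush      = [ (λ (fromL , fromC) → inj₁ ( extend-from≡ lo≤p p≤hi el fromL
                                               , extend-from≡ lo≤p p≤hi ec fromC))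
                   , (λ (endL , endC) → inj₂ ( top≡ (extend-end≡ lo≤p p≤hi el endL)
                                             , top≡ (extend-end≡ lo≤p p≤hi ec endC)))
                   ] (flush I)
    ; notFull    = λ notFull′ → within ec (notFull I (subst (λ t → suc t < k) size≡ notFull′))
    }
    where
      hi = toℕ c + length U
      lo≤p : lo I ≤ toℕ p
      lo≤p = subst (lo I ≤_) lo≡ (m≤m+n (lo I) (length D′))
      p≤hi : toℕ p ≤ hi
      p≤hi = subst (toℕ p ≤_) hi≡ (m≤m+n (toℕ p) (length U′))
      top≡ : ∀ {t} → t ≡ suc hi → t ≡ suc (toℕ p + length U′)
      top≡ t≡ = trans t≡ (cong suc (sym hi≡))
      within : ∀ {x w x′ w′} → Extend x w (toℕ p) x′ w′ → Within (lo I) (suc hi) x w →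
               Within (lo I) (suc (toℕ p + length U′)) x′ w′
      within {x′ = x′} {w′} e w∈ =
        subst (λ t → Within (lo I) t x′ w′) (cong suc (sym hi≡)) (extend-within lo≤p p≤hi e w∈)

  record Next (c : Fin N) (R F : List (Fin N)) (lf af : ℕ) (p : Fin N) : Set where
    constructor next
    field
      {U′ D′ R′} : List (Fin N)
      lruNext≡   : lruNext k p (c ∷ R) ≡ p ∷ R′
      inv        : Inv p U′ D′ R′ (fifoNext k p F) (lf + cost k p (c ∷ R)) (af + cost k p F)

  hitNext : ∀ {c p : Fin N} {R F lf af U′ D′ R′} → cost k p (c ∷ R) ≡ 0 → lruNext k p (c ∷ R) ≡ p ∷ R′ →
    Inv p U′ D′ R′ (fifoNext k p F) lf (af + cost k p F) → Next c R F lf af p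
  hitNext {p = p} {F = F} {lf} {af} {U′} {D′} {R′} cost≡ next≡ J =
    next next≡ (subst (λ t → Inv p U′ D′ R′ (fifoNext k p F) t (af + cost k p F))
                      (sym (trans (cong (lf +_) cost≡) (+-identityʳ lf))) J)

  faultNext : ∀ {c p : Fin N} {R F lf af U′ D′ R′} → cost k p (c ∷ R) ≡ 1 → lruNext k p (c ∷ R) ≡ p ∷ R′ →
    Inv p U′ D′ R′ (fifoNext k p F) (lf + 1) (af + cost k p F) → Next c R F lf af p
  faultNext {p = p} {F = F} {lf} {af} {U′} {D′} {R′} cost≡ next≡ J =
    next next≡ (subst (λ t → Inv p U′ D′ R′ (fifoNext k p F) (lf + t) (af + cost k p F)) (sym cost≡) J)

  step-repeat : ∀ {c U D R F lf af} → Inv c U D R F lf af → Next c R F lf af c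
  step-repeat I with lru-repeat k (lruShape I)
  ... | cost≡ , next≡ =
    hitNext cost≡ next≡ (hitInv I _ (inj₁ refl) (lruShape I) refl (lo+lower I) refl)

  step-upHit : ∀ {c p u U D R F lf af} → Inv c (u ∷ U) D R F lf af → suc (toℕ c) ≡ toℕ p → Next c R F lf af p
  step-upHit {c} {p} {u} {U} {D} I 1+c≡p with lru-hitAbove k (lruShape I) 1+c≡p
  ... | cost≡ , R′ , next≡ , shape′ =
    hitNext cost≡ next≡
      (hitInv I p (inj₂ (inj₁ 1+c≡p)) shape′ (+-suc (length U) (length D))
        (trans (+-suc (lo I) (length D)) (trans (cong suc (lo+lower I)) 1+c≡p))
        (trans (cong (_+ length U) (sym 1+c≡p)) (sym (+-suc (toℕ c) (length U)))))

  step-downHit : ∀ {c p d U D R F lf af} → Inv c U (d ∷ D) R F lf af → suc (toℕ p) ≡ toℕ c → Next c R F lf af p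
  step-downHit {c} {p} {d} {U} {D} I 1+p≡c with lru-hitBelow k (lruShape I) 1+p≡c
  ... | cost≡ , R′ , next≡ , shape′ =
    hitNext cost≡ next≡
      (hitInv I p (inj₂ (inj₂ 1+p≡c)) shape′ (sym (+-suc (length U) (length D)))
        (suc-injective (trans (sym (+-suc (lo I) (length D))) (trans (lo+lower I) (sym 1+p≡c))))
        (trans (+-suc (toℕ p) (length U)) (cong (_+ length U) 1+p≡c)))

  faultInv : ∀ {c U D R F lf af} → Inv c U D R F lf af → (p : Fin N) {U′ D′ R′ : List (Fin N)} →
    Shape p U′ D′ R′ → suc (length U′ + length D′) ≤ k →
    (lo′ : ℕ) → lo′ + length D′ ≡ toℕ p →
    (C : Credit (lf + 1) (fifoNext k p F) (af + cost k p F) (toℕ p)) →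
    (toℕ p ≡ lo′ × from (anchor C) ≡ lo′) ⊎
    (toℕ p + 1 ≡ suc (toℕ p + length U′) × end (anchor C) ≡ suc (toℕ p + length U′)) →
    (suc (length U′ + length D′) < k → Within lo′ (suc (toℕ p + length U′)) (from (anchor C)) (width (anchor C))) →
    Inv p U′ D′ R′ (fifoNext k p F) (lf + 1) (af + cost k p F)
  faultInv {F = F} {af = af} I p {U′} {D′} shape′ lruSize′ lo′ lo≡ C flush′ notFull′ = record
    { lruShape   = shape′
    ; lruSize    = lruSize′
    ; lo         = lo′
    ; lo+lower   = lo≡
    ; fifoSize   = fifoNext-length k 1≤k p F (fifoSize I)
    ; credit     = C
    ; last       = fresh (fifoNext k p F) (af + cost k p F) p (fifoNext-here k p F)
    ; lastCheap  = credit⇒lru≤fifo C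
    ; lastSmall  = fifoNext-length k 1≤k p F (fifoSize I)
    ; lastWithin = subst (lo′ ≤_) lo≡ (m≤m+n lo′ (length D′))
                 , subst (_≤ suc (toℕ p + length U′)) (sym (+-comm (toℕ p) 1)) (s≤s (m≤m+n (toℕ p) (length U′)))
    ; flush      = flush′
    ; notFull    = notFull′
    }

  lastCredit : ∀ {c U D R F lf af} (I : Inv c U D R F lf af) → k ≤ width (last I) → Credit lf F af (toℕ c)
  lastCredit I k≤width = anchor⇒credit (last I) (lastCheap I) (≤-trans (lastSmall I) k≤width)

  -- When the credit window does not reach the fault at p = hi + 1, the cache
  -- is full and `last` spans exactly the cached window [lo, hi]; extended by
  -- p it is a credit for the new fault.
  lastAbove : ∀ {c p D R F lf af} → (I : Inv c [] D R F lf af) → suc (toℕ c) ≡ toℕ p →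
    from (last I) ≡ lo I → k ≤ suc (length D) →
    Σ (Credit (lf + 1) (fifoNext k p F) (af + cost k p F) (toℕ p)) λ C′ → end (anchor C′) ≡ suc (toℕ p + 0)
  lastAbove {c} {p} {D} I 1+c≡p from≡lo full with follow (last I) (inj₂ (inj₁ 1+c≡p))
  ... | _ , _ , above p≡end =
        credit-grow k (lastCredit I (subst (k ≤_) (sym width≡) full)) p (above p≡end) ,
        trans (+-suc (from (last I)) (width (last I))) (cong suc (trans (sym p≡end) (sym (+-identityʳ (toℕ p)))))
    where
      width≡ : width (last I) ≡ suc (length D)
      width≡ = +-cancelˡ-≡ (lo I) _ _ (begin
        lo I + width (last I)            ≡⟨ cong (_+ width (last I)) (sym from≡lo) ⟩
        from (last I) + width (last I)   ≡⟨ sym p≡end ⟩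
        toℕ p                            ≡⟨ sym 1+c≡p ⟩
        suc (toℕ c)                      ≡⟨ cong suc (sym (lo+lower I)) ⟩
        suc (lo I + length D)            ≡⟨ sym (+-suc (lo I) (length D)) ⟩
        lo I + suc (length D)            ∎)
        where open ≡-Reasoning
  ... | _ , _ , below 1+p≡from = ⊥-elim (up-not-below (proj₁ (current (last I))) 1+c≡p 1+p≡from)
  ... | _ , _ , inside _ p<end = ⊥-elim (beyond-top 1+c≡p p<end (proj₂ (lastWithin I)))

  -- A fault at p = hi + 1 is paid either by the credit window, if it reaches
  -- p, or else (the cache being full) by the window of `last`.
  creditAbove : ∀ {c p D R F lf af} → (I : Inv c [] D R F lf af) → suc (toℕ c) ≡ toℕ p →
    Σ (Credit (lf + 1) (fifoNext k p F) (af + cost k p F) (toℕ p)) λ C′ →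
      end (anchor C′) ≡ suc (toℕ p + 0) × (suc (length D) < k → lo I ≤ from (anchor C′))
  creditAbove {c} {p} {D} I 1+c≡p with follow (anchor (credit I)) (inj₂ (inj₁ 1+c≡p))
  ... | _ , _ , above p≡end =
        credit-grow k (credit I) p (above p≡end) ,
        trans (+-suc (from C) (width C)) (cong suc (trans (sym p≡end) (sym (+-identityʳ (toℕ p))))) ,
        λ notFull′ → proj₁ (notFull I notFull′)
    where C = anchor (credit I)
  ... | _ , _ , below 1+p≡from = ⊥-elim (up-not-below (proj₁ (current (anchor (credit I)))) 1+c≡p 1+p≡from)
  ... | _ , _ , inside _ p<end with flush I | suc (length D) <? k
  ...   | inj₂ (_ , end≡) | _ = ⊥-elim (beyond-top 1+c≡p p<end (≤-reflexive end≡))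
  ...   | inj₁ _ | yes notFull′ = ⊥-elim (beyond-top 1+c≡p p<end (proj₂ (notFull I notFull′)))
  ...   | inj₁ (from≡lo , _) | no notFull′ =
          let (C′ , end≡) = lastAbove I 1+c≡p from≡lo (≮⇒≥ notFull′)
          in C′ , end≡ , λ notFull″ → ⊥-elim (notFull′ notFull″)

  lastBelow : ∀ {c p U R F lf af} → (I : Inv c U [] R F lf af) → suc (toℕ p) ≡ toℕ c →
    end (last I) ≡ suc (toℕ c + length U) → k ≤ suc (length U + 0) →
    Σ (Credit (lf + 1) (fifoNext k p F) (af + cost k p F) (toℕ p)) λ C′ → from (anchor C′) ≡ toℕ p
  lastBelow {c} {p} {U} I 1+p≡c end≡ full with follow (last I) (inj₂ (inj₂ 1+p≡c))
  ... | _ , _ , below 1+p≡from =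
        credit-grow k (lastCredit I (subst (k ≤_) (sym width≡) full)) p (below 1+p≡from) ,
        refl
    where
      width≡ : width (last I) ≡ suc (length U + 0)
      width≡ = +-cancelˡ-≡ (toℕ c) _ _ (begin
        toℕ c + width (last I)          ≡⟨ cong (_+ width (last I)) (trans (sym 1+p≡c) 1+p≡from) ⟩
        from (last I) + width (last I)  ≡⟨ end≡ ⟩
        suc (toℕ c + length U)          ≡⟨ sym (+-suc (toℕ c) (length U)) ⟩
        toℕ c + suc (length U)          ≡⟨ cong (λ t → toℕ c + suc t) (sym (+-identityʳ (length U))) ⟩
        toℕ c + suc (length U + 0)      ∎)
        where open ≡-Reasoning
  ... | _ , _ , above p≡end = ⊥-elim (down-not-above {from (last I)} {width (last I)} (proj₂ (current (last I))) 1+p≡c p≡end)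
  ... | _ , _ , inside from≤p _ = ⊥-elim (beyond-bottom 1+p≡c (lo+lower I) (proj₁ (lastWithin I)) from≤p)

  creditBelow : ∀ {c p U R F lf af} → (I : Inv c U [] R F lf af) → suc (toℕ p) ≡ toℕ c →
    Σ (Credit (lf + 1) (fifoNext k p F) (af + cost k p F) (toℕ p)) λ C′ →
      from (anchor C′) ≡ toℕ p × (suc (length U + 0) < k → end (anchor C′) ≤ suc (toℕ c + length U))
  creditBelow {c} {p} {U} I 1+p≡c with follow (anchor (credit I)) (inj₂ (inj₂ 1+p≡c))
  ... | _ , _ , below 1+p≡from =
        credit-grow k (credit I) p (below 1+p≡from) , refl ,
        λ notFull′ → subst (_≤ suc (toℕ c + length U))
                           (sym (trans (+-suc (toℕ p) (width C)) (cong (_+ width C) 1+p≡from)))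
                           (proj₂ (notFull I notFull′))
    where C = anchor (credit I)
  ... | _ , _ , above p≡end = ⊥-elim (down-not-above {from C} {width C} (proj₂ (current C)) 1+p≡c p≡end)
    where C = anchor (credit I)
  ... | _ , _ , inside from≤p _ with flush I | suc (length U + 0) <? k
  ...   | inj₁ (_ , from≡lo) | _ = ⊥-elim (beyond-bottom 1+p≡c (lo+lower I) (≤-reflexive (sym from≡lo)) from≤p)
  ...   | inj₂ _ | yes notFull′ = ⊥-elim (beyond-bottom 1+p≡c (lo+lower I) (proj₁ (notFull I notFull′)) from≤p)
  ...   | inj₂ (end≡ , _) | no notFull′ =
          let (C′ , from≡) = lastBelow I 1+p≡c end≡ (≮⇒≥ notFull′)
          in C′ , from≡ , λ notFull″ → ⊥-elim (notFull′ notFull″)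

  step-upFault : ∀ {c p D R F lf af} → Inv c [] D R F lf af → suc (toℕ c) ≡ toℕ p → Next c R F lf af p
  step-upFault {c} {p} {D} I 1+c≡p
    with lru-faultAbove k (lruShape I) 1+c≡p | creditAbove I 1+c≡p | insertFront-cases k p (c ∷ D)
  ... | cost≡ , next≡ | C′ , end≡ , lo≤from | inj₁ (room , inserted) =
    faultNext cost≡ (trans next≡ inserted)
      (faultInv I p (shape-onlyBelow p (c ∷ D) desc′) (<ᵇ-true _ k room)
                (lo I) (trans (+-suc (lo I) (length D)) c+1≡p) C′ (inj₂ (p+1≡ , end≡))
                (λ notFull′ → lo≤from (<-trans (n<1+n _) notFull′) , ≤-reflexive end≡))
    where
      desc′ = 1+c≡p , Shape.descending (lruShape I)
      c+1≡p = trans (cong suc (lo+lower I)) 1+c≡p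
      p+1≡ = trans (+-comm (toℕ p) 1) (cong suc (sym (+-identityʳ (toℕ p))))
  ... | cost≡ , next≡ | C′ , end≡ , _ | inj₂ (full , inserted) =
    faultNext cost≡ (trans next≡ inserted)
      (faultInv I p (shape-onlyBelow p (dropLast (c ∷ D)) (descending-dropLast (toℕ p) (c ∷ D) desc′))
                (subst (λ t → suc t ≤ k) (sym shrunk) (lruSize I))
                (suc (lo I)) (trans (cong (suc (lo I) +_) shrunk) c+1≡p) C′ (inj₂ (p+1≡ , end≡))
                (λ notFull′ → ⊥-elim (<-irrefl refl (<-≤-trans (subst (λ t → suc t < k) shrunk notFull′)
                                                               (<ᵇ-false _ k full)))))
    where
      desc′ = 1+c≡p , Shape.descending (lruShape I)
      c+1≡p = trans (cong suc (lo+lower I)) 1+c≡p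
      p+1≡ = trans (+-comm (toℕ p) 1) (cong suc (sym (+-identityʳ (toℕ p))))
      shrunk = dropLast-length (c ∷ D)

  step-downFault : ∀ {c p U R F lf af} → Inv c U [] R F lf af → suc (toℕ p) ≡ toℕ c → Next c R F lf af p
  step-downFault {c} {p} {U} I 1+p≡c
    with lru-faultBelow k (lruShape I) 1+p≡c | creditBelow I 1+p≡c | insertFront-cases k p (c ∷ U)
  ... | cost≡ , next≡ | C′ , from≡p , end≤ | inj₁ (room , inserted) =
    faultNext cost≡ (trans next≡ inserted)
      (faultInv I p (shape-onlyAbove p (c ∷ U) asc′)
                (subst (λ t → suc t ≤ k) (sym (+-identityʳ _)) (<ᵇ-true _ k room))
                (toℕ p) (+-identityʳ (toℕ p)) C′ (inj₁ (refl , from≡p))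
                (λ notFull′ → ≤-reflexive (sym from≡p) ,
                   subst (end (anchor C′) ≤_) top≡ (end≤ (<-trans (s≤s (≤-reflexive (+-identityʳ _)))
                     (subst (λ t → suc t < k) (+-identityʳ _) notFull′)))))
    where
      asc′ = sym 1+p≡c , subst (λ t → Ascending t U) (sym 1+p≡c) (Shape.ascending (lruShape I))
      top≡ = cong suc (trans (cong (_+ length U) (sym 1+p≡c)) (sym (+-suc (toℕ p) (length U))))
  ... | cost≡ , next≡ | C′ , from≡p , _ | inj₂ (full , inserted) =
    faultNext cost≡ (trans next≡ inserted)
      (faultInv I p (shape-onlyAbove p (dropLast (c ∷ U)) (ascending-dropLast (toℕ p) (c ∷ U) asc′))
                (subst (λ t → suc (t + 0) ≤ k) (sym shrunk) (lruSize I))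
                (toℕ p) (+-identityʳ (toℕ p)) C′ (inj₁ (refl , from≡p))
                (λ notFull′ → ⊥-elim (<-irrefl refl (<-≤-trans (subst (λ t → suc t < k) (trans (+-identityʳ _) shrunk)
                                                                      notFull′)
                                                               (<ᵇ-false _ k full)))))
    where
      asc′ = sym 1+p≡c , subst (λ t → Ascending t U) (sym 1+p≡c) (Shape.ascending (lruShape I))
      shrunk = dropLast-length (c ∷ U)

  step : ∀ {c U D R F lf af} → Inv c U D R F lf af → (p : Fin N) → (c ≡ p) ⊎ PathAdj c p → Next c R F lf af p
  step I p (inj₁ refl) = step-repeat I
  step {U = []} I p (inj₂ (inj₁ up)) = step-upFault I up
  step {U = _ ∷ _} I p (inj₂ (inj₁ up)) = step-upHit I up
  step {D = []} I p (inj₂ (inj₂ down)) = step-downFault I down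
  step {D = _ ∷ _} I p (inj₂ (inj₂ down)) = step-downHit I down

  run : ∀ {c U D R F lf af} → Inv c U D R F lf af → ∀ rest → Respects (c ∷ rest) →
    lf + lruRun k (c ∷ R) rest ≤ af + fifoRun k F rest
  run {lf = lf} {af} I [] _ = subst₂ _≤_ (sym (+-identityʳ lf)) (sym (+-identityʳ af)) (inv⇒lru≤fifo I)
  run {c} {R = R} {F} {lf} {af} I (p ∷ rest) (move , walk) with step I p move
  ... | next {R′ = R′} next≡ J =
    begin
      lf + lruRun k (c ∷ R) (p ∷ rest)                 ≡⟨ cong (lf +_) (lruRun-step k p (c ∷ R) rest) ⟩
      lf + (lcost + lruRun k (lruNext k p (c ∷ R)) rest) ≡⟨ cong (λ L → lf + (lcost + lruRun k L rest)) next≡ ⟩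
      lf + (lcost + lruRun k (p ∷ R′) rest)            ≡⟨ sym (+-assoc lf lcost _) ⟩
      lf + lcost + lruRun k (p ∷ R′) rest              ≤⟨ run J rest walk ⟩
      af + fcost + fifoRun k (fifoNext k p F) rest     ≡⟨ +-assoc af fcost _ ⟩
      af + (fcost + fifoRun k (fifoNext k p F) rest)   ≡⟨ cong (af +_) (sym (fifoRun-step k p F rest)) ⟩
      af + fifoRun k F (p ∷ rest)                      ∎
    where
      open ≤-Reasoning
      lcost = cost k p (c ∷ R)
      fcost = cost k p F

  -- The state after the first request p: both caches hold p, both faulted once.
  -- The credit is anchored before the walk began (empty snapshot).
  initial : (p : Fin N) → Inv p [] [] [] (p ∷ []) 1 1
  initial p = record
    { lruShape   = shape-onlyBelow p [] tt
    ; lruSize    = 1≤k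
    ; lo         = toℕ p
    ; lo+lower   = +-identityʳ (toℕ p)
    ; fifoSize   = 1≤k
    ; credit     = record { anchor = beforeWalk ; lruPaid = 0 ; budget = ≤-refl ; cheaper = z≤n }
    ; last       = fresh (p ∷ []) 1 p (memAt-here p [])
    ; lastCheap  = ≤-refl
    ; lastSmall  = 1≤k
    ; lastWithin = unit
    ; flush      = inj₁ (refl , refl)
    ; notFull    = λ _ → unit
    }
    where
      unit : Within (toℕ p) (suc (toℕ p + 0)) (toℕ p) 1
      unit = ≤-refl , ≤-reflexive (trans (+-comm (toℕ p) 1) (cong suc (sym (+-identityʳ (toℕ p)))))
      inWindow : toℕ p ≤ toℕ p × toℕ p < toℕ p + 1
      inWindow = ≤-refl , m<m+n (toℕ p) (s≤s z≤n)
      only-p : ∀ z → memAt z (p ∷ []) ≡ true → toℕ p ≡ z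
      only-p z z∈ = [ (λ p≡z → p≡z) , (λ ()) ] (memAt-cons⁻ z p [] z∈)
      beforeWalk : Anchor (p ∷ []) 1 (toℕ p)
      beforeWalk = record
        { snapshot = []
        ; paid     = 0
        ; from     = toℕ p
        ; width    = 1
        ; charged  = ≤-refl
        ; covered  = λ z z∈ → inj₂ (subst (λ t → toℕ p ≤ t × t < toℕ p + 1) (only-p z z∈) inWindow)
        ; current  = inWindow
        }

lru≤fifo : ∀ {N} k → 1 ≤ k → (J : List (Fin N)) → Respects J → LRU k J ≤ FIFO k J
lru≤fifo k 1≤k [] _ = z≤n
lru≤fifo (suc k) 1≤k (p ∷ rest) walk = Invariant.run (suc k) 1≤k (Invariant.initial (suc k) 1≤k p) rest walk

theorem2 : (k : ℕ) → 1 ≤ k → (N : ℕ) → (I : List (Fin N)) → Respects I →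
    (mL mF : ℕ) → IsWorstOrder (LRU k) I mL → IsWorstOrder (FIFO k) I mF →
    mL ≤ mF
theorem2 k 1≤k _ I _ mL mF ((J , J↭I , walkJ , LRU-J≡mL) , _) (_ , fifoWorst) =
  begin
    mL        ≡⟨ sym LRU-J≡mL ⟩
    LRU k J   ≤⟨ lru≤fifo k 1≤k J walkJ ⟩
    FIFO k J  ≤⟨ fifoWorst J J↭I walkJ ⟩
    mF        ∎
  where open ≤-Reasoning
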